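{- Let $G$ be a connected graph of order $n_1\ge2$ and $H$ a graph of order $n_2\ge2$. Let $\alpha$ be the number of connected components of $H$ of order greater than one, denote these components by $C_1,\dots,C_\alpha$, and let $\beta$ be the number of isolated vertices of $H$. Then for every integer $k\ge1$ (with $G\odot^0H:=G$): $$Z(G\odot^{k}H)\le\begin{cases} n_1(n_2+1)^{k-1}\sum_{l=1}^{\alpha}Z(C_l)+n_1(n_2+1)^{k-1}(\beta-1), & \alpha\ge1,\ \beta\ge2,\\ Z(G\odot^{k-1}H)+n_1(n_2+1)^{k-1}\sum_{l=1}^{\alpha}Z(C_l), & \alpha\ge1,\ \beta=0,\\ n_1(n_2+1)^{k-1}\sum_{l=1}^{\alpha}Z(C_l)+n_1(n_2+1)^{k-1}-1, & \alpha\ge1,\ \beta=1,\\ n_1(n_2+1)^{k-1}(n_2-1), & \alpha=0,\ \beta\ge2. \end{cases}$$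
   Context: Graphs are finite, simple, undirected. Zero forcing: given a set $S$ of initially black vertices (others white), the color-change rule turns a white vertex black if it is the only white neighbor of some black vertex; $S$ is a zero forcing set if eventually all vertices become black; $Z(G)$ is the minimum size of a zero forcing set. Corona: for $G$ of order $n_1$, $G\odot H$ is obtained from $G$ and $n_1$ disjoint copies of $H$ by joining the $i$-th vertex of $G$ to every vertex of the $i$-th copy of $H$; $G\odot^1H=G\odot H$, $G\odot^kH=(G\odot^{k-1}H)\odot H$ for $k\ge2$. -}

module Defs where

open import Data.Nat using (ℕ; zero; suc; _+_; _*_; _≤_)
open import Data.Bool using (Bool; true; false; _∧_; T; not)
open import Data.Fin using (Fin; splitAt; remQuot)
open import Data.Fin.Properties using (_≟_)
open import Data.Fin.Subset using (Subset; _∈_; ∣_∣)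
open import Data.Sum using (_⊎_; inj₁; inj₂)
open import Data.Product using (_×_; _,_; ∃; ∃-syntax; Σ-syntax)
open import Data.List using (List; filterᵇ; length; allFin)
open import Data.Bool.ListAction using (all)
open import Relation.Nullary using (¬_; does)
open import Relation.Binary.PropositionalEquality using (_≡_; _≢_)

Graph : ℕ → Set
Graph n = Fin n → Fin n → Bool

Adj : ∀ {n} → Graph n → Fin n → Fin n → Set
Adj G u v = T (G u v)

IsSimple : ∀ {n} → Graph n → Set
IsSimple {n} G = (∀ (u v : Fin n) → G u v ≡ G v u) × (∀ (u : Fin n) → G u u ≡ false)

data Reach {n} (G : Graph n) : Fin n → Fin n → Set where
  here : ∀ {u} → Reach G u u
  step : ∀ {u w v} → Adj G u w → Reach G w v → Reach G u v

Connected : ∀ {n} → Graph n → Set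
Connected {n} G = ∀ (u v : Fin n) → Reach G u v

-- vertices that end up black starting from the black set S,
-- under the colour-change rule (least set closed under forcing)
data Black {n} (G : Graph n) (S : Subset n) : Fin n → Set where
  initial : ∀ {v} → v ∈ S → Black G S v
  force   : ∀ {u v} → Black G S u → Adj G u v
          → (∀ w → Adj G u w → w ≢ v → Black G S w)
          → Black G S v

IsZeroForcingSet : ∀ {n} → Graph n → Subset n → Set
IsZeroForcingSet {n} G S = ∀ (v : Fin n) → Black G S v

IsZ : ∀ {n} → Graph n → ℕ → Set
IsZ {n} G z = (∃[ S ] (IsZeroForcingSet G S × ∣ S ∣ ≡ z))
            × (∀ (S : Subset n) → IsZeroForcingSet G S → z ≤ ∣ S ∣)

ZLe : ∀ {n} → Graph n → ℕ → Set
ZLe {n} G b = ∃[ S ] (IsZeroForcingSet G S × ∣ S ∣ ≤ b)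

-- corona G ⊙ H: vertices Fin (n + n * m); inj₁ i is vertex i of G,
-- inj₂ (i , h) is vertex h of the i-th copy of H
corona : ∀ {n m} → Graph n → Graph m → Graph (n + n * m)
corona {n} {m} G H x y with splitAt n x | splitAt n y
... | inj₁ a | inj₁ b = G a b
... | inj₁ a | inj₂ q with remQuot {n} m q
...   | (i , _) = does (a ≟ i)
corona {n} {m} G H x y | inj₂ p | inj₁ b with remQuot {n} m p
...   | (i , _) = does (i ≟ b)
corona {n} {m} G H x y | inj₂ p | inj₂ q with remQuot {n} m p | remQuot {n} m q
...   | (i , h) | (j , h') = does (i ≟ j) ∧ H h h'

coronaOrder : ℕ → ℕ → ℕ → ℕ
coronaOrder n₁ n₂ zero = n₁
coronaOrder n₁ n₂ (suc k) = coronaOrder n₁ n₂ k + coronaOrder n₁ n₂ k * n₂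

iterCorona : ∀ {n₁ n₂} → Graph n₁ → Graph n₂ → (k : ℕ) → Graph (coronaOrder n₁ n₂ k)
iterCorona G H zero = G
iterCorona G H (suc k) = corona (iterCorona G H k) H

induced : ∀ {n m} → Graph n → (Fin m → Fin n) → Graph m
induced H f i j = H (f i) (f j)

isolatedᵇ : ∀ {n} → Graph n → Fin n → Bool
isolatedᵇ {n} H v = all (λ u → not (H v u)) (allFin n)

Isolated : ∀ {n} → Graph n → Fin n → Set
Isolated H v = T (isolatedᵇ H v)

numIsolated : ∀ {n} → Graph n → ℕ
numIsolated {n} H = length (filterᵇ (isolatedᵇ H) (allFin n))

-- C l (l < α) enumerates the connected components of H of order > 1:
-- component l has m l ≥ 2 vertices, listed injectively by f l.
record NontrivialComponents {n} (H : Graph n) (α : ℕ) (m : Fin α → ℕ)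
       (f : (l : Fin α) → Fin (m l) → Fin n) : Set where
  field
    large     : ∀ l → 2 ≤ m l
    injective : ∀ l (i j : Fin (m l)) → f l i ≡ f l j → i ≡ j
    connected : ∀ l (i j : Fin (m l)) → Reach H (f l i) (f l j)
    closed    : ∀ l (i : Fin (m l)) (u : Fin n) → Reach H (f l i) u → ∃[ j ] (f l j ≡ u)
    disjoint  : ∀ l l' (i : Fin (m l)) (j : Fin (m l')) → f l i ≡ f l' j → l ≡ l'
    covering  : ∀ (v : Fin n) → ¬ Isolated H v → ∃[ l ] ∃[ i ] (f l i ≡ v)

-- In K = G ⊙ H call the vertices of G "hubs" (hub a) and vertex h of the i-th
-- copy of H a "leaf" (leaf i h).  Four forcing facts in K drive the proof:
--   * an isolated vertex of H that is black in copy i forces hub i;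
--   * a black hub forces the last white leaf of its copy;
--   * once hub i is black, a zero forcing set of a component C_l placed in
--     copy i turns that component of copy i black;
--   * if each black hub blackens its copy, forcing in G lifts to the hubs.
-- They give, for an arbitrary graph G of order N, zero forcing sets of G ⊙ H:
--   (β ≥ 2) Z-sets of all C_l and all isolated vertices but one, in every copy;
--   (β = 0) a Z-set of G plus Z-sets of all C_l in every copy;
--   (β = 1) Z-sets of all C_l in every copy plus the isolated vertex in every
--           copy but one; the hub of that copy is forced along an edge of G;
--   (α = 0) the case β ≥ 2 with an empty sum over components.
-- Theorem 6 applies them to G ⊙^(k-1) H, which has order n₁ (n₂+1)^(k-1) and
-- always has an edge.
module Submission where

open import Defs
open import Data.Nat using (ℕ; zero; suc; _+_; _*_; _∸_; _^_; _≤_; z≤n; s≤s; >-nonZero⁻¹)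
open import Data.Nat.Properties hiding (_≟_)
open import Data.Bool using (true; false; _∧_; not; T; T?)
open import Data.Bool.Properties using (T-∧; T-≡)
open import Data.Fin using (Fin; zero; suc; splitAt; remQuot; combine; join; _↑ˡ_; _↑ʳ_; punchIn; punchOut)
open import Data.Fin.Properties using (_≟_; splitAt-↑ˡ; splitAt-↑ʳ; join-splitAt; remQuot-combine; combine-remQuot; punchIn-punchOut; nonZeroIndex)
open import Data.Fin.Subset using (Subset; ⁅_⁆; _∪_; ∣_∣) renaming (⊥ to ∅; _∈_ to _∈ˢ_)
open import Data.Fin.Subset.Properties using (x∈⁅x⁆; x∈p∪q⁺; ∣⊥∣≡0; ∣⁅x⁆∣≡1; ∣p∣≤∣x∷p∣)
import Data.Vec.Base as Vec
open Vec using ([]; _∷_)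
open import Data.List using (List; []; _∷_; _++_; map; concat; tabulate; length; allFin; filterᵇ)
open import Data.List.Properties using (length-++; length-map; length-tabulate; length-filter)
open import Data.List.Membership.Propositional using (_∈_)
open import Data.List.Membership.Propositional.Properties
  using (∈-map⁺; ∈-++⁺ˡ; ∈-++⁺ʳ; ∈-allFin; ∈-tabulate⁺; ∈-concat⁺′; ∈-filter⁺; ∈-filter⁻)
open import Data.List.Relation.Unary.Any using (here; there)
import Data.List.Relation.Unary.All as All
open import Data.List.Relation.Unary.All.Properties using (all⁺)
open import Data.Nat.ListAction using (sum)
open import Data.Product using (_×_; _,_; ∃-syntax; proj₁; proj₂)
open import Data.Sum using (inj₁; inj₂)
open import Data.Empty using (⊥-elim)
open import Function using (Equivalence)
open import Relation.Nullary using (¬_; Dec; yes; no; does)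
open import Relation.Nullary.Decidable using (dec-true)
open import Relation.Binary.PropositionalEquality

setOf : ∀ {n} → List (Fin n) → Subset n
setOf []       = ∅
setOf (x ∷ xs) = ⁅ x ⁆ ∪ setOf xs

∈-setOf : ∀ {n} {x : Fin n} (xs : List (Fin n)) → x ∈ xs → x ∈ˢ setOf xs
∈-setOf (y ∷ xs) (here refl) = x∈p∪q⁺ (inj₁ (x∈⁅x⁆ y))
∈-setOf (y ∷ xs) (there x∈xs) = x∈p∪q⁺ (inj₂ (∈-setOf xs x∈xs))

∣p∪q∣≤∣p∣+∣q∣ : ∀ {n} (p q : Subset n) → ∣ p ∪ q ∣ ≤ ∣ p ∣ + ∣ q ∣
∣p∪q∣≤∣p∣+∣q∣ []          []          = z≤n
∣p∪q∣≤∣p∣+∣q∣ (true ∷ p)  (b ∷ q)     =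
  s≤s (≤-trans (∣p∪q∣≤∣p∣+∣q∣ p q) (+-monoʳ-≤ ∣ p ∣ (∣p∣≤∣x∷p∣ b q)))
∣p∪q∣≤∣p∣+∣q∣ (false ∷ p) (true ∷ q)  =
  ≤-trans (s≤s (∣p∪q∣≤∣p∣+∣q∣ p q)) (≤-reflexive (sym (+-suc ∣ p ∣ ∣ q ∣)))
∣p∪q∣≤∣p∣+∣q∣ (false ∷ p) (false ∷ q) = ∣p∪q∣≤∣p∣+∣q∣ p q

∣setOf∣≤length : ∀ {n} (xs : List (Fin n)) → ∣ setOf xs ∣ ≤ length xs
∣setOf∣≤length {n} []  = ≤-reflexive (∣⊥∣≡0 n)
∣setOf∣≤length (x ∷ xs) = begin
  ∣ ⁅ x ⁆ ∪ setOf xs ∣       ≤⟨ ∣p∪q∣≤∣p∣+∣q∣ ⁅ x ⁆ (setOf xs) ⟩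
  ∣ ⁅ x ⁆ ∣ + ∣ setOf xs ∣   ≡⟨ cong (_+ ∣ setOf xs ∣) (∣⁅x⁆∣≡1 x) ⟩
  suc ∣ setOf xs ∣           ≤⟨ s≤s (∣setOf∣≤length xs) ⟩
  suc (length xs)            ∎
  where open ≤-Reasoning

elements : ∀ {n} → Subset n → List (Fin n)
elements []          = []
elements (true ∷ p)  = zero ∷ map suc (elements p)
elements (false ∷ p) = map suc (elements p)

length-elements : ∀ {n} (p : Subset n) → length (elements p) ≡ ∣ p ∣
length-elements []          = refl
length-elements (true ∷ p)  = cong suc (trans (length-map suc (elements p)) (length-elements p))
length-elements (false ∷ p) = trans (length-map suc (elements p)) (length-elements p)

∈-elements : ∀ {n} {x : Fin n} (p : Subset n) → x ∈ˢ p → x ∈ elements p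
∈-elements (true ∷ p)  Vec.here        = here refl
∈-elements (true ∷ p)  (Vec.there x∈p) = there (∈-map⁺ suc (∈-elements p x∈p))
∈-elements (false ∷ p) (Vec.there x∈p) = ∈-map⁺ suc (∈-elements p x∈p)

length-concat-tabulate : ∀ {A : Set} {n} (g : Fin n → List A) (c : Fin n → ℕ)
  → (∀ i → length (g i) ≤ c i) → length (concat (tabulate g)) ≤ sum (tabulate c)
length-concat-tabulate {n = zero}  g c bound = z≤n
length-concat-tabulate {n = suc n} g c bound =
  ≤-trans (≤-reflexive (length-++ (g zero)))
    (+-mono-≤ (bound zero)
      (length-concat-tabulate (λ i → g (suc i)) (λ i → c (suc i)) (λ i → bound (suc i))))

sum-tabulate-const : ∀ n c → sum (tabulate {n = n} (λ _ → c)) ≡ n * c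
sum-tabulate-const zero    c = refl
sum-tabulate-const (suc n) c = cong (c +_) (sum-tabulate-const n c)

∈-concat-tabulate : ∀ {A : Set} {n} (g : Fin n → List A) (i : Fin n) {x : A}
  → x ∈ g i → x ∈ concat (tabulate g)
∈-concat-tabulate g i x∈gi = ∈-concat⁺′ x∈gi (∈-tabulate⁺ i)

allBut : ∀ {n} → Fin n → List (Fin n)
allBut {suc n} i₀ = map (punchIn i₀) (allFin n)

length-allBut : ∀ {n} (i₀ : Fin n) → length (allBut i₀) ≡ n ∸ 1
length-allBut {suc n} i₀ = trans (length-map (punchIn i₀) (allFin n)) (length-tabulate _)

∈-allBut : ∀ {n} {i₀ i : Fin n} → i ≢ i₀ → i ∈ allBut i₀
∈-allBut {suc n} {i₀} {i} i≢i₀ =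
  subst (_∈ allBut i₀) (punchIn-punchOut (≢-sym i≢i₀))
        (∈-map⁺ (punchIn i₀) (∈-allFin (punchOut (≢-sym i≢i₀))))

T-does : ∀ {P : Set} (d : Dec P) → T (does d) → P
T-does (yes p) _ = p

T-does-refl : ∀ {n} (i : Fin n) → T (does (i ≟ i))
T-does-refl i = Equivalence.from T-≡ (dec-true (i ≟ i) refl)

T-not⇒¬T : ∀ {b} → T (not b) → ¬ T b
T-not⇒¬T {true} ()

isolated⇒¬Adj : ∀ {M} (H : Graph M) {h h' : Fin M} → Isolated H h → ¬ Adj H h h'
isolated⇒¬Adj {M} H {h} {h'} iso =
  T-not⇒¬T (All.lookup (all⁺ (λ u → not (H h u)) (allFin M) iso) (∈-allFin h'))

isolatedList : ∀ {M} → Graph M → List (Fin M)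
isolatedList {M} H = filterᵇ (isolatedᵇ H) (allFin M)

isolated⇒∈ : ∀ {M} (H : Graph M) {h} → Isolated H h → h ∈ isolatedList H
isolated⇒∈ H {h} iso = ∈-filter⁺ (λ x → T? (isolatedᵇ H x)) (∈-allFin h) iso

∈⇒isolated : ∀ {M} (H : Graph M) {h} → h ∈ isolatedList H → Isolated H h
∈⇒isolated {M} H h∈ = proj₂ (∈-filter⁻ (λ x → T? (isolatedᵇ H x)) {xs = allFin M} h∈)

numIsolated≤order : ∀ {M} (H : Graph M) → numIsolated H ≤ M
numIsolated≤order {M} H = ≤-trans (length-filter (λ x → T? (isolatedᵇ H x)) (allFin M))
                                  (≤-reflexive (length-tabulate _))

numIsolated≡0⇒¬Isolated : ∀ {M} (H : Graph M) → numIsolated H ≡ 0 → ∀ h → ¬ Isolated H h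
numIsolated≡0⇒¬Isolated H β≡0 h iso with isolatedList H | isolated⇒∈ H iso | β≡0
... | _ ∷ _ | _ | ()

HasEdge : ∀ {N} → Graph N → Set
HasEdge {N} G = ∃[ a ] ∃[ b ] (Adj G a b × a ≢ b)

module Corona {N M : ℕ} (G : Graph N) (H : Graph M) where

  K : Graph (N + N * M)
  K = corona G H

  hub : Fin N → Fin (N + N * M)
  hub a = a ↑ˡ (N * M)

  leaf : Fin N → Fin M → Fin (N + N * M)
  leaf i h = N ↑ʳ combine i h

  K-hub-hub : ∀ a b → K (hub a) (hub b) ≡ G a b
  K-hub-hub a b rewrite splitAt-↑ˡ N a (N * M) | splitAt-↑ˡ N b (N * M) = refl

  K-hub-leaf : ∀ a i h → K (hub a) (leaf i h) ≡ does (a ≟ i)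
  K-hub-leaf a i h rewrite splitAt-↑ˡ N a (N * M) | splitAt-↑ʳ N (N * M) (combine i h) =
    cong (λ p → does (a ≟ proj₁ p)) (remQuot-combine {N} {M} i h)

  K-leaf-hub : ∀ i h b → K (leaf i h) (hub b) ≡ does (i ≟ b)
  K-leaf-hub i h b rewrite splitAt-↑ˡ N b (N * M) | splitAt-↑ʳ N (N * M) (combine i h) =
    cong (λ p → does (proj₁ p ≟ b)) (remQuot-combine {N} {M} i h)

  K-leaf-leaf : ∀ i h j h' → K (leaf i h) (leaf j h') ≡ (does (i ≟ j) ∧ H h h')
  K-leaf-leaf i h j h'
    rewrite splitAt-↑ʳ N (N * M) (combine i h) | splitAt-↑ʳ N (N * M) (combine j h') =
    cong₂ (λ p q → does (proj₁ p ≟ proj₁ q) ∧ H (proj₂ p) (proj₂ q))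
          (remQuot-combine {N} {M} i h) (remQuot-combine {N} {M} j h')

  data View : Fin (N + N * M) → Set where
    isHub  : ∀ a → View (hub a)
    isLeaf : ∀ i h → View (leaf i h)

  view : ∀ x → View x
  view x with splitAt N x in eq
  ... | inj₁ a = subst View x≡ (isHub a)
    where
    x≡ : hub a ≡ x
    x≡ = trans (cong (join N (N * M)) (sym eq)) (join-splitAt N (N * M) x)
  ... | inj₂ q = subst View x≡ (isLeaf (proj₁ (remQuot {N} M q)) (proj₂ (remQuot {N} M q)))
    where
    x≡ : leaf (proj₁ (remQuot {N} M q)) (proj₂ (remQuot {N} M q)) ≡ x
    x≡ = trans (cong (N ↑ʳ_) (combine-remQuot {N} M q))
               (trans (cong (join N (N * M)) (sym eq)) (join-splitAt N (N * M) x))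

  hub≢leaf : ∀ {a i h} → hub a ≢ leaf i h
  hub≢leaf {a} {i} {h} e
    with trans (sym (splitAt-↑ˡ N a (N * M)))
               (trans (cong (splitAt N) e) (splitAt-↑ʳ N (N * M) (combine i h)))
  ... | ()

  hub-hub⁻ : ∀ {a b} → Adj K (hub a) (hub b) → Adj G a b
  hub-hub⁻ {a} {b} = subst T (K-hub-hub a b)

  hub-hub⁺ : ∀ {a b} → Adj G a b → Adj K (hub a) (hub b)
  hub-hub⁺ {a} {b} = subst T (sym (K-hub-hub a b))

  hub-leaf⁻ : ∀ {a i h} → Adj K (hub a) (leaf i h) → a ≡ i
  hub-leaf⁻ {a} {i} {h} adj = T-does (a ≟ i) (subst T (K-hub-leaf a i h) adj)

  hub-leaf⁺ : ∀ {i h} → Adj K (hub i) (leaf i h)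
  hub-leaf⁺ {i} {h} = subst T (sym (K-hub-leaf i i h)) (T-does-refl i)

  leaf-hub⁻ : ∀ {i h b} → Adj K (leaf i h) (hub b) → i ≡ b
  leaf-hub⁻ {i} {h} {b} adj = T-does (i ≟ b) (subst T (K-leaf-hub i h b) adj)

  leaf-hub⁺ : ∀ {i h} → Adj K (leaf i h) (hub i)
  leaf-hub⁺ {i} {h} = subst T (sym (K-leaf-hub i h i)) (T-does-refl i)

  leaf-leaf⁻ : ∀ {i h j h'} → Adj K (leaf i h) (leaf j h') → i ≡ j × Adj H h h'
  leaf-leaf⁻ {i} {h} {j} {h'} adj =
    let (i≡j , hh') = Equivalence.to T-∧ (subst T (K-leaf-leaf i h j h') adj)
    in T-does (i ≟ j) i≡j , hh'

  leaf-leaf⁺ : ∀ {i h h'} → Adj H h h' → Adj K (leaf i h) (leaf i h')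
  leaf-leaf⁺ {i} {h} {h'} hh' =
    subst T (sym (K-leaf-leaf i h i h')) (Equivalence.from T-∧ (T-does-refl i , hh'))

  module Forcing (S : Subset (N + N * M)) where

    B : Fin (N + N * M) → Set
    B = Black K S

    allBlack : (∀ a → B (hub a)) → (∀ i h → B (leaf i h)) → IsZeroForcingSet K S
    allBlack hubs leaves x with view x
    ... | isHub a    = hubs a
    ... | isLeaf i h = leaves i h

    -- The only neighbour of an isolated leaf is its hub, which it forces.
    isolatedForcesHub : ∀ {i h} → Isolated H h → B (leaf i h) → B (hub i)
    isolatedForcesHub {i} {h} iso black = force black leaf-hub⁺ others
      where
      others : ∀ w → Adj K (leaf i h) w → w ≢ hub i → B w
      others w adj w≢ with view w
      ... | isHub b    = ⊥-elim (w≢ (cong hub (sym (leaf-hub⁻ adj))))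
      ... | isLeaf j h' = ⊥-elim (isolated⇒¬Adj H iso (proj₂ (leaf-leaf⁻ adj)))

    hubForcesLast : ∀ {i h₀} → B (hub i) → (∀ b → Adj G i b → B (hub b))
      → (∀ h → h ≢ h₀ → B (leaf i h)) → B (leaf i h₀)
    hubForcesLast {i} {h₀} black hubs leaves = force black hub-leaf⁺ others
      where
      others : ∀ w → Adj K (hub i) w → w ≢ leaf i h₀ → B w
      others w adj w≢ with view w
      ... | isHub b = hubs b (hub-hub⁻ adj)
      ... | isLeaf j h with hub-leaf⁻ adj
      ... | refl = leaves h (λ h≡h₀ → w≢ (cong (leaf i) h≡h₀))

    hubForcesHub : ∀ {j i} → B (hub j) → Adj G j i
      → (∀ b → Adj G j b → b ≢ i → B (hub b)) → (∀ h → B (leaf j h)) → B (hub i)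
    hubForcesHub {j} {i} black ji hubs leaves = force black (hub-hub⁺ ji) others
      where
      others : ∀ w → Adj K (hub j) w → w ≢ hub i → B w
      others w adj w≢ with view w
      ... | isHub b = hubs b (hub-hub⁻ adj) (λ b≡i → w≢ (cong hub b≡i))
      ... | isLeaf j' h with hub-leaf⁻ adj
      ... | refl = leaves h

    module _ (S' : Subset N) (seeded : ∀ a → a ∈ˢ S' → hub a ∈ˢ S)
             (copy : ∀ i → B (hub i) → ∀ h → B (leaf i h)) where

      liftGraph : ∀ {a} → Black G S' a → B (hub a)
      liftGraph (initial a∈S') = initial (seeded _ a∈S')
      liftGraph (force {u} {v} black uv rest) = force (liftGraph black) (hub-hub⁺ uv) others
        where
        others : ∀ w → Adj K (hub u) w → w ≢ hub v → B w
        others w adj w≢ with view w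
        ... | isHub b = liftGraph (rest b (hub-hub⁻ adj) (λ b≡v → w≢ (cong hub b≡v)))
        ... | isLeaf j h with hub-leaf⁻ adj
        ... | refl = copy u (liftGraph black) h

    module Components (α : ℕ) (m : Fin α → ℕ) (f : (l : Fin α) → Fin (m l) → Fin M)
                      (nc : NontrivialComponents H α m f)
                      (Zset : (l : Fin α) → Subset (m l))
                      (Zset-forcing : ∀ l → IsZeroForcingSet (induced H (f l)) (Zset l))
                      (seeded : ∀ i l a → a ∈ˢ Zset l → leaf i (f l a) ∈ˢ S) where
      open NontrivialComponents nc

      -- With hub i black, forcing in C_l lifts to copy i: the hub is the only
      -- neighbour of a copy vertex outside its component.
      liftComponent : ∀ {i} l → B (hub i) → ∀ {a} → Black (induced H (f l)) (Zset l) a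
        → B (leaf i (f l a))
      liftComponent {i} l hubBlack (initial a∈Z) = initial (seeded i l _ a∈Z)
      liftComponent {i} l hubBlack (force {u} {v} black uv rest) =
        force (liftComponent l hubBlack black) (leaf-leaf⁺ uv) others
        where
        others : ∀ w → Adj K (leaf i (f l u)) w → w ≢ leaf i (f l v) → B w
        others w adj w≢ with view w
        ... | isHub b = subst B (cong hub (leaf-hub⁻ adj)) hubBlack
        ... | isLeaf j h' with leaf-leaf⁻ adj
        ... | refl , uh' with closed l u h' (step uh' here)
        ... | (a , refl) =
          liftComponent l hubBlack (rest a uh' (λ a≡v → w≢ (cong (λ x → leaf i (f l x)) a≡v)))

      nonIsolatedBlack : ∀ {i} → B (hub i) → ∀ h → ¬ Isolated H h → B (leaf i h)
      nonIsolatedBlack hubBlack h ¬iso with covering h ¬iso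
      ... | (l , a , refl) = liftComponent l hubBlack (Zset-forcing l a)

      -- Once all hubs are black and every isolated leaf other than the copies
      -- of h₀ is black, each hub forces its copy of h₀ last.
      completion : (h₀ : Fin M) → (∀ a → B (hub a))
        → (∀ i h → Isolated H h → h ≢ h₀ → B (leaf i h)) → IsZeroForcingSet K S
      completion h₀ hubs isolatedBlack = allBlack hubs leaves
        where
        allButLast : ∀ i h → h ≢ h₀ → B (leaf i h)
        allButLast i h h≢h₀ with T? (isolatedᵇ H h)
        ... | yes iso = isolatedBlack i h iso h≢h₀
        ... | no ¬iso = nonIsolatedBlack (hubs i) h ¬iso
        leaves : ∀ i h → B (leaf i h)
        leaves i h with h ≟ h₀
        ... | no h≢h₀  = allButLast i h h≢h₀
        ... | yes refl = hubForcesLast (hubs i) (λ b _ → hubs b) (allButLast i)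

module Constructions {N M : ℕ} (G : Graph N) (H : Graph M)
         (α : ℕ) (m : Fin α → ℕ) (f : (l : Fin α) → Fin (m l) → Fin M)
         (nc : NontrivialComponents H α m f)
         (z : Fin α → ℕ) (hz : ∀ l → IsZ (induced H (f l)) (z l)) where
  open Corona G H

  Zset : (l : Fin α) → Subset (m l)
  Zset l = proj₁ (proj₁ (hz l))

  Zset-forcing : ∀ l → IsZeroForcingSet (induced H (f l)) (Zset l)
  Zset-forcing l = proj₁ (proj₂ (proj₁ (hz l)))

  ΣZ : ℕ
  ΣZ = sum (tabulate z)

  componentSeeds : List (Fin M)
  componentSeeds = concat (tabulate (λ l → map (f l) (elements (Zset l))))

  length-componentSeeds : length componentSeeds ≤ ΣZ
  length-componentSeeds = length-concat-tabulate _ z λ l →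
    ≤-reflexive (trans (length-map (f l) (elements (Zset l)))
                       (trans (length-elements (Zset l)) (proj₂ (proj₂ (proj₁ (hz l))))))

  ∈-componentSeeds : ∀ l a → a ∈ˢ Zset l → f l a ∈ componentSeeds
  ∈-componentSeeds l a a∈Z = ∈-concat-tabulate _ l (∈-map⁺ (f l) (∈-elements (Zset l) a∈Z))

  inEveryCopy : List (Fin M) → List (Fin (N + N * M))
  inEveryCopy xs = concat (tabulate (λ i → map (leaf i) xs))

  length-inEveryCopy : ∀ xs → length (inEveryCopy xs) ≤ N * length xs
  length-inEveryCopy xs = ≤-trans
    (length-concat-tabulate _ (λ _ → length xs) (λ i → ≤-reflexive (length-map (leaf i) xs)))
    (≤-reflexive (sum-tabulate-const N (length xs)))

  ∈-inEveryCopy : ∀ {h} xs i → h ∈ xs → leaf i h ∈ inEveryCopy xs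
  ∈-inEveryCopy xs i h∈xs = ∈-concat-tabulate _ i (∈-map⁺ (leaf i) h∈xs)

  -- β ≥ 2: in every copy, the Z-sets of all components and all isolated
  -- vertices but h₀; the isolated vertex h₁ forces the hub.
  zle-manyIsolated : 2 ≤ numIsolated H → ZLe K (N * ΣZ + N * (numIsolated H ∸ 1))
  zle-manyIsolated 2≤β with isolatedList H in eq
  zle-manyIsolated (s≤s (s≤s _)) | h₀ ∷ h₁ ∷ rest = setOf L , forcing , size
    where
    seeds : List (Fin M)
    seeds = componentSeeds ++ h₁ ∷ rest
    L : List (Fin (N + N * M))
    L = inEveryCopy seeds
    open Forcing (setOf L)
    seeded : ∀ i h → h ∈ seeds → leaf i h ∈ˢ setOf L
    seeded i h h∈ = ∈-setOf L (∈-inEveryCopy seeds i h∈)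
    open Components α m f nc Zset Zset-forcing
      (λ i l a a∈Z → seeded i (f l a) (∈-++⁺ˡ (∈-componentSeeds l a a∈Z)))
    hubs : ∀ a → B (hub a)
    hubs a = isolatedForcesHub (∈⇒isolated H (subst (h₁ ∈_) (sym eq) (there (here refl))))
                               (initial (seeded a h₁ (∈-++⁺ʳ componentSeeds (here refl))))
    isolatedBlack : ∀ i h → Isolated H h → h ≢ h₀ → B (leaf i h)
    isolatedBlack i h iso h≢h₀ with subst (h ∈_) eq (isolated⇒∈ H iso)
    ... | here h≡h₀ = ⊥-elim (h≢h₀ h≡h₀)
    ... | there h∈ = initial (seeded i h (∈-++⁺ʳ componentSeeds h∈))
    forcing : IsZeroForcingSet K (setOf L)
    forcing = completion h₀ hubs isolatedBlack
    size : ∣ setOf L ∣ ≤ N * ΣZ + N * suc (length rest)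
    size = begin
      ∣ setOf L ∣                               ≤⟨ ∣setOf∣≤length L ⟩
      length L                                  ≤⟨ length-inEveryCopy seeds ⟩
      N * length seeds                          ≡⟨ cong (N *_) (length-++ componentSeeds) ⟩
      N * (length componentSeeds + suc (length rest))
        ≤⟨ *-monoʳ-≤ N (+-monoˡ-≤ _ length-componentSeeds) ⟩
      N * (ΣZ + suc (length rest))              ≡⟨ *-distribˡ-+ N ΣZ _ ⟩
      N * ΣZ + N * suc (length rest)            ∎
      where open ≤-Reasoning

  -- α = 0: the previous set consists of isolated vertices only.
  zle-noComponents : α ≡ 0 → 2 ≤ numIsolated H → ZLe K (N * (M ∸ 1))
  zle-noComponents refl 2≤β with zle-manyIsolated 2≤β
  ... | S , forcing , size = S , forcing , ≤-trans size bound
    where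
    bound : N * 0 + N * (numIsolated H ∸ 1) ≤ N * (M ∸ 1)
    bound rewrite *-zeroʳ N = *-monoʳ-≤ N (∸-monoˡ-≤ 1 (numIsolated≤order H))

  -- β = 0: a zero forcing set of G on the hubs and the Z-sets of all
  -- components in every copy; each black hub blackens its copy.
  zle-noIsolated : numIsolated H ≡ 0 → (z' : ℕ) → IsZ G z' → ZLe K (z' + N * ΣZ)
  zle-noIsolated β≡0 z' ((S' , S'-forcing , ∣S'∣≡z') , _) = setOf L , forcing , size
    where
    L : List (Fin (N + N * M))
    L = map hub (elements S') ++ inEveryCopy componentSeeds
    open Forcing (setOf L)
    open Components α m f nc Zset Zset-forcing
      (λ i l a a∈Z → ∈-setOf L (∈-++⁺ʳ (map hub (elements S'))
                                  (∈-inEveryCopy componentSeeds i (∈-componentSeeds l a a∈Z))))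
    copy : ∀ i → B (hub i) → ∀ h → B (leaf i h)
    copy i hubBlack h = nonIsolatedBlack hubBlack h (numIsolated≡0⇒¬Isolated H β≡0 h)
    hubs : ∀ a → B (hub a)
    hubs a = liftGraph S' (λ b b∈S' → ∈-setOf L (∈-++⁺ˡ (∈-map⁺ hub (∈-elements S' b∈S'))))
                       copy (S'-forcing a)
    forcing : IsZeroForcingSet K (setOf L)
    forcing = allBlack hubs (λ i → copy i (hubs i))
    size : ∣ setOf L ∣ ≤ z' + N * ΣZ
    size = begin
      ∣ setOf L ∣                                 ≤⟨ ∣setOf∣≤length L ⟩
      length L                                    ≡⟨ length-++ (map hub (elements S')) ⟩
      length (map hub (elements S')) + length (inEveryCopy componentSeeds)
        ≤⟨ +-mono-≤ (≤-reflexive (trans (length-map hub (elements S'))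
                                        (trans (length-elements S') ∣S'∣≡z')))
                    (≤-trans (length-inEveryCopy componentSeeds)
                             (*-monoʳ-≤ N length-componentSeeds)) ⟩
      z' + N * ΣZ                                 ∎
      where open ≤-Reasoning

  -- β = 1, with an edge j₀ i₀ of G: the Z-sets of all components in every copy
  -- and the isolated vertex h₀ in every copy except copy i₀.  Hub j₀ forces hub i₀.
  zle-oneIsolated : HasEdge G → numIsolated H ≡ 1 → ZLe K (N * ΣZ + N ∸ 1)
  zle-oneIsolated (j₀ , i₀ , j₀i₀ , j₀≢i₀) β≡1 with isolatedList H in eq
  zle-oneIsolated (j₀ , i₀ , j₀i₀ , j₀≢i₀) refl | h₀ ∷ [] = setOf L , forcing , size
    where
    isolatedCopies : List (Fin (N + N * M))
    isolatedCopies = map (λ i → leaf i h₀) (allBut i₀)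
    L : List (Fin (N + N * M))
    L = inEveryCopy componentSeeds ++ isolatedCopies
    open Forcing (setOf L)
    open Components α m f nc Zset Zset-forcing
      (λ i l a a∈Z → ∈-setOf L (∈-++⁺ˡ (∈-inEveryCopy componentSeeds i (∈-componentSeeds l a a∈Z))))
    h₀-isolated : Isolated H h₀
    h₀-isolated = ∈⇒isolated H (subst (h₀ ∈_) (sym eq) (here refl))
    only-h₀ : ∀ {h} → Isolated H h → h ≡ h₀
    only-h₀ iso with subst (_ ∈_) eq (isolated⇒∈ H iso)
    ... | here h≡h₀ = h≡h₀
    h₀-black : ∀ i → i ≢ i₀ → B (leaf i h₀)
    h₀-black i i≢i₀ =
      initial (∈-setOf L (∈-++⁺ʳ (inEveryCopy componentSeeds) (∈-map⁺ (λ i → leaf i h₀) (∈-allBut i≢i₀))))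
    hubs≢i₀ : ∀ i → i ≢ i₀ → B (hub i)
    hubs≢i₀ i i≢i₀ = isolatedForcesHub h₀-isolated (h₀-black i i≢i₀)
    copy-j₀ : ∀ h → B (leaf j₀ h)
    copy-j₀ h with T? (isolatedᵇ H h)
    ... | no ¬iso = nonIsolatedBlack (hubs≢i₀ j₀ j₀≢i₀) h ¬iso
    ... | yes iso rewrite only-h₀ iso = h₀-black j₀ j₀≢i₀
    hubs : ∀ a → B (hub a)
    hubs a with a ≟ i₀
    ... | no a≢i₀  = hubs≢i₀ a a≢i₀
    ... | yes refl = hubForcesHub (hubs≢i₀ j₀ j₀≢i₀) j₀i₀ (λ b _ → hubs≢i₀ b) copy-j₀
    forcing : IsZeroForcingSet K (setOf L)
    forcing = completion h₀ hubs (λ i h iso h≢h₀ → ⊥-elim (h≢h₀ (only-h₀ iso)))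
    size : ∣ setOf L ∣ ≤ N * ΣZ + N ∸ 1
    size = begin
      ∣ setOf L ∣                        ≤⟨ ∣setOf∣≤length L ⟩
      length L                           ≡⟨ length-++ (inEveryCopy componentSeeds) ⟩
      length (inEveryCopy componentSeeds) + length isolatedCopies
        ≤⟨ +-mono-≤ (≤-trans (length-inEveryCopy componentSeeds) (*-monoʳ-≤ N length-componentSeeds))
                    (≤-reflexive (trans (length-map _ (allBut i₀)) (length-allBut i₀))) ⟩
      N * ΣZ + (N ∸ 1)                   ≡⟨ sym (+-∸-assoc (N * ΣZ) (>-nonZero⁻¹ N {{nonZeroIndex i₀}})) ⟩
      N * ΣZ + N ∸ 1                     ∎
      where open ≤-Reasoning

coronaOrder≡ : ∀ n₁ n₂ j → coronaOrder n₁ n₂ j ≡ n₁ * (n₂ + 1) ^ j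
coronaOrder≡ n₁ n₂ zero    = sym (*-identityʳ n₁)
coronaOrder≡ n₁ n₂ (suc j) = begin
  c + c * n₂                        ≡⟨ cong (_+ c * n₂) (sym (*-identityʳ c)) ⟩
  c * 1 + c * n₂                    ≡⟨ sym (*-distribˡ-+ c 1 n₂) ⟩
  c * (1 + n₂)                      ≡⟨ cong (c *_) (+-comm 1 n₂) ⟩
  c * (n₂ + 1)                      ≡⟨ cong (_* (n₂ + 1)) (coronaOrder≡ n₁ n₂ j) ⟩
  n₁ * (n₂ + 1) ^ j * (n₂ + 1)      ≡⟨ *-assoc n₁ _ (n₂ + 1) ⟩
  n₁ * ((n₂ + 1) ^ j * (n₂ + 1))    ≡⟨ cong (n₁ *_) (*-comm ((n₂ + 1) ^ j) (n₂ + 1)) ⟩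
  n₁ * (n₂ + 1) ^ suc j             ∎
  where
  open ≡-Reasoning
  c : ℕ
  c = coronaOrder n₁ n₂ j

connected⇒HasEdge : ∀ {n} (G : Graph n) → IsSimple G → Connected G → 2 ≤ n → HasEdge G
connected⇒HasEdge G (_ , loopless) connected (s≤s (s≤s _)) with connected zero (suc zero)
... | step {w = w} 0w _ = zero , w , 0w , λ 0≡w → subst T (trans (cong (G zero) (sym 0≡w)) (loopless zero)) 0w

corona-HasEdge : ∀ {N M} (G : Graph N) (H : Graph M) → Fin N → Fin M → HasEdge (corona G H)
corona-HasEdge G H a h = hub a , leaf a h , hub-leaf⁺ , hub≢leaf
  where open Corona G H

iterCorona-HasEdge : ∀ {n₁ n₂} (G : Graph n₁) (H : Graph n₂) → HasEdge G → Fin n₂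
  → ∀ j → HasEdge (iterCorona G H j)
iterCorona-HasEdge G H edge h zero    = edge
iterCorona-HasEdge G H edge h (suc j) =
  corona-HasEdge (iterCorona G H j) H (proj₁ (iterCorona-HasEdge G H edge h j)) h

mainTheorem6 : ∀ {n₁ n₂ : ℕ} (G : Graph n₁) (H : Graph n₂)
  → IsSimple G → IsSimple H → Connected G → 2 ≤ n₁ → 2 ≤ n₂
  → (α : ℕ) (m : Fin α → ℕ) (f : (l : Fin α) → Fin (m l) → Fin n₂)
  → NontrivialComponents H α m f
  → (z : Fin α → ℕ) → (∀ l → IsZ (induced H (f l)) (z l))
  → (k : ℕ) → 1 ≤ k
  → ((1 ≤ α) → (2 ≤ numIsolated H)
      → ZLe (iterCorona G H k)
            (n₁ * (n₂ + 1) ^ (k ∸ 1) * sum (tabulate z)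
              + n₁ * (n₂ + 1) ^ (k ∸ 1) * (numIsolated H ∸ 1)))
    × ((1 ≤ α) → (numIsolated H ≡ 0)
      → (z' : ℕ) → IsZ (iterCorona G H (k ∸ 1)) z'
      → ZLe (iterCorona G H k)
            (z' + n₁ * (n₂ + 1) ^ (k ∸ 1) * sum (tabulate z)))
    × ((1 ≤ α) → (numIsolated H ≡ 1)
      → ZLe (iterCorona G H k)
            (n₁ * (n₂ + 1) ^ (k ∸ 1) * sum (tabulate z)
              + n₁ * (n₂ + 1) ^ (k ∸ 1) ∸ 1))
    × ((α ≡ 0) → (2 ≤ numIsolated H)
      → ZLe (iterCorona G H k) (n₁ * (n₂ + 1) ^ (k ∸ 1) * (n₂ ∸ 1)))
mainTheorem6 {n₁} {n₂} G H simpleG _ connectedG 2≤n₁ (s≤s (s≤s _)) α m f nc z hz (suc j) _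
  rewrite sym (coronaOrder≡ n₁ n₂ j) =
    (λ _ → zle-manyIsolated) , (λ _ → zle-noIsolated) , (λ _ → zle-oneIsolated edge) , zle-noComponents
  where
  open Constructions (iterCorona G H j) H α m f nc z hz
  edge : HasEdge (iterCorona G H j)
  edge = iterCorona-HasEdge G H (connected⇒HasEdge G simpleG connectedG 2≤n₁) zero j
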